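{- Let $\mathcal{F}\subseteq\mathcal{B}_n$, $q$ a positive integer and $\varepsilon>0$. Let $\mathcal{T}$ be a $q$-strong $1$-marked chain family from $\mathcal{F}$ and let $\mathcal{M}=\mathcal{T}[q]$. For each $i\in[q]$ let $\mathcal{L}^i(\mathcal{M})$ be the set of $F\in\mathcal{F}$ such that $F$ is the $i$-th member of $Q$ for some $(\chi,Q)\in\mathcal{M}$. If $|\mathcal{T}|\ge\varepsilon n!$, then for each $i\in[q]$, $$|\mathcal{L}^i(\mathcal{M})|\ge\frac{\varepsilon}{q}\min_{F\in\mathcal{F}}\binom{n}{|F|}.$$
   Context: $\mathcal{B}_n$ is the power set of $[n]$. A full chain is a chain $\emptyset=C_0\subset\dots\subset C_n=[n]$; $\mathcal{C}$ is the set of full chains. A $1$-marked chain family from $\mathcal{F}$ is a set $\mathcal{T}$ of pairs $(\chi,F)$ with $\chi\in\mathcal{C}$, $F\in\mathcal{F}\cap\chi$; $|\mathcal{T}|$ is the number of pairs; $\mathcal{T}(\chi)=\{F:(\chi,F)\in\mathcal{T}\}$; $\mathcal{T}$ is $q$-strong if $|\mathcal{T}(\chi)|\ge q$ whenever $\mathcal{T}(\chi)\ne\emptyset$. The $q$-th power is $\mathcal{T}[q]=\{(\chi,Q):Q\subseteq\mathcal{T}(\chi),|Q|=q\}$, where $Q$ is regarded as a chain $F_1\supsetneq\dots\supsetneq F_q$ and its $i$-th member is $F_i$ (the $i$-th largest).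
   Formalization: The parameter ε ranges over the positive rationals. -}

module Defs where

open import Data.Nat using (ℕ; zero; suc; _≤_; _<_; _⊓_)
open import Data.Nat.Combinatorics using (_C_)
open import Data.Bool using (Bool)
import Data.Bool.Properties as BoolP
open import Data.Fin using (Fin; zero; suc; inject₁; fromℕ; toℕ)
open import Data.Fin.Subset using (Subset; ⊥; ⊤; _⊂_; ∣_∣)
open import Data.Vec using (Vec; lookup)
import Data.Vec.Properties as VecP
import Data.Vec.Membership.Propositional as VecMem
open import Data.List using (List; []; _∷_; length; map; filter)
open import Data.List.Membership.Propositional using (_∈_)
open import Data.Product using (_×_; _,_; proj₁; proj₂; ∃; ∃-syntax; Σ-syntax)
open import Data.Integer using (+_)
open import Data.Rational using (ℚ; _/_)
open import Relation.Binary.PropositionalEquality using (_≡_)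
open import Relation.Binary.Definitions using (DecidableEquality)

_≟S_ : {n : ℕ} → DecidableEquality (Subset n)
_≟S_ = VecP.≡-dec BoolP._≟_

Chain : ℕ → Set
Chain n = Vec (Subset n) (suc n)

_≟C_ : {n : ℕ} → DecidableEquality (Chain n)
_≟C_ = VecP.≡-dec _≟S_

IsFullChain : {n : ℕ} → Chain n → Set
IsFullChain {n} c =
  (lookup c zero ≡ ⊥) × (lookup c (fromℕ n) ≡ ⊤) ×
  ((i : Fin n) → lookup c (inject₁ i) ⊂ lookup c (suc i))

_∈χ_ : {n : ℕ} → Subset n → Chain n → Set
F ∈χ χ = VecMem._∈_ F χ

-- A 1-marked chain family is represented by a list of pairs (χ , F);
-- it is a set, so the list is required to be duplicate-free (see the
-- statement), and |T| = length T.
MarkedFamily : ℕ → Set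
MarkedFamily n = List (Chain n × Subset n)

IsMarkedFamilyFrom : {n : ℕ} → List (Subset n) → MarkedFamily n → Set
IsMarkedFamilyFrom 𝓕 T =
  ∀ {χ F} → (χ , F) ∈ T → IsFullChain χ × F ∈ 𝓕 × F ∈χ χ

T⟨_⟩ : {n : ℕ} → MarkedFamily n → Chain n → List (Subset n)
T⟨ T ⟩ χ = map proj₂ (filter (λ p → proj₁ p ≟C χ) T)

IsStrong : {n : ℕ} → ℕ → MarkedFamily n → Set
IsStrong q T = ∀ χ → (∃[ F ] ((χ , F) ∈ T)) → q ≤ length (T⟨ T ⟩ χ)

StrictlyDecreasing : {n q : ℕ} → Vec (Subset n) q → Set
StrictlyDecreasing {n} {q} Q =
  (j k : Fin q) → toℕ j < toℕ k → lookup Q k ⊂ lookup Q j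

-- (χ , Q) ∈ T[q]: Q is a q-element subset of T(χ), regarded as the
-- chain F_1 ⊋ ... ⊋ F_q (stored in this order; lookup Q i is the
-- (i+1)-th largest member, i.e. the "(i+1)-th member" with 1-based indexing).
InPower : {n : ℕ} (q : ℕ) → MarkedFamily n → Chain n → Vec (Subset n) q → Set
InPower q T χ Q = StrictlyDecreasing Q × ((j : Fin q) → (χ , lookup Q j) ∈ T)

-- L^i(M) for M = T[q]: F ∈ 𝓕 which is the i-th member of Q for some
-- (χ , Q) ∈ M.  (i : Fin q, 0-based, stands for the 1-based index i+1 ∈ [q].)
InL : {n : ℕ} (𝓕 : List (Subset n)) (q : ℕ) (T : MarkedFamily n) → Fin q → Subset n → Set
InL {n} 𝓕 q T i F =
  F ∈ 𝓕 × ∃[ χ ] ∃[ Q ] (InPower q T χ Q × lookup Q i ≡ F)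

-- min_{F ∈ 𝓕} binom(n, |F|)  (value 0 for empty 𝓕 is irrelevant: the
-- hypotheses force 𝓕 ≠ ∅).
minBinom : (n : ℕ) → List (Subset n) → ℕ
minBinom n [] = 0
minBinom n (F ∷ []) = n C ∣ F ∣
minBinom n (F ∷ G ∷ 𝓕) = (n C ∣ F ∣) ⊓ minBinom n (G ∷ 𝓕)

ℕ→ℚ : ℕ → ℚ
ℕ→ℚ m = (+ m) / 1

{-# OPTIONS --safe #-}
module Submission where

-- Let χ be a chain with T(χ) = {F₁ ⊋ ⋯ ⊋ F_k}, k ≥ q. Its k − q + 1 runs of q consecutive
-- members F_j ⊋ ⋯ ⊋ F_{j+q−1} belong to T[q], and their i-th members F_{j+i−1} are pairwise
-- distinct; as k ≤ q (k − q + 1), the pairs (χ , F) with F the i-th member of some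
-- (χ , Q) ∈ T[q] number at least |T| / q. Counting full chains step by step (a saturated chain
-- from A to B has at most |B| − |A| choices for its second member) shows that a set F lies on
-- at most |F|! (n − |F|)! = n! / C(n, |F|) full chains, so each F ∈ Lⁱ(T[q]) occurs in at most
-- n! / min C(n, |F|) of these pairs. Hence |Lⁱ(T[q])| · n! ≥ min C(n, |F|) · |T| / q, which with
-- |T| ≥ ε n! is the claim.

open import Defs

module Counting where

  open import Data.Nat using (ℕ; suc; _+_; _*_; _≤_; z≤n; s≤s)
  open import Data.Nat.Properties
  open import Data.Nat.ListAction using (sum)
  open import Data.List using (List; []; _∷_; length; map; filter; concatMap; deduplicate)
  open import Data.List.Properties using (filter-notAll; length-map; length-++)
  open import Data.List.Membership.Propositional using (_∈_)
  open import Data.List.Membership.Propositional.Properties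
    using (∈-filter⁺; ∈-map⁺; ∈-map⁻; ∈-deduplicate⁺; ∈-deduplicate⁻; ∈-++⁻)
  open import Data.List.Relation.Binary.Subset.Propositional using () renaming (_⊆_ to _⊆ˡ_)
  open import Data.List.Relation.Unary.All as All using (All; []; _∷_)
  open import Data.List.Relation.Unary.All.Properties using (all-filter) renaming (map⁺ to All-map⁺; filter⁺ to All-filter⁺)
  open import Data.List.Relation.Unary.Any as Any using (here; there)
  open import Data.List.Relation.Unary.Unique.Propositional using (Unique; []; _∷_)
  import Data.List.Relation.Unary.Unique.Propositional.Properties as Unique
  open import Data.List.Relation.Unary.Unique.DecPropositional.Properties using (deduplicate-!)
  open import Data.Product as Product using (_×_; _,_; proj₁; proj₂; ∃-syntax)
  open import Data.Sum using (inj₁; inj₂)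
  open import Data.Empty using (⊥-elim)
  open import Function using (_∘_)
  open import Relation.Nullary using (¬_; ¬?; yes; no)
  open import Relation.Unary using (Decidable)
  open import Relation.Binary.PropositionalEquality using (_≡_; _≢_; refl; sym; trans; cong; cong₂; subst)
  open import Relation.Binary.Definitions using (DecidableEquality)

  AtMost : {A : Set} → ℕ → (A → Set) → Set
  AtMost k P = ∀ {xs} → Unique xs → All P xs → length xs ≤ k

  module _ {A : Set} (_≟_ : DecidableEquality A) where

    Unique∧⊆⇒length≤ : ∀ {xs ys : List A} → Unique xs → xs ⊆ˡ ys → length xs ≤ length ys
    Unique∧⊆⇒length≤ {[]} _ _ = z≤n
    Unique∧⊆⇒length≤ {x ∷ xs} {ys} (x∉xs ∷ xs!) xs⊆ys =
      ≤-trans (s≤s (Unique∧⊆⇒length≤ xs! xs⊆ys∖x))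
              (filter-notAll x≢? ys (Any.map (λ x≡y x≢y → x≢y x≡y) (xs⊆ys (here refl))))
      where
      x≢? : Decidable (x ≢_)
      x≢? y = ¬? (x ≟ y)
      xs⊆ys∖x : xs ⊆ˡ filter x≢? ys
      xs⊆ys∖x z∈xs = ∈-filter⁺ x≢? (xs⊆ys (there z∈xs)) (All.lookup x∉xs z∈xs)

  module _ {A : Set} {P : A → Set} where

    atMost-∅ : (∀ {x} → ¬ P x) → AtMost 0 P
    atMost-∅ ¬P {[]} _ _ = z≤n
    atMost-∅ ¬P {_ ∷ _} _ (p ∷ _) = ⊥-elim (¬P p)

    atMost-mono : ∀ {Q : A → Set} {k} → (∀ {x} → P x → Q x) → AtMost k Q → AtMost k P
    atMost-mono P⇒Q atMost u ps = atMost u (All.map P⇒Q ps)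

    atMost-≤ : ∀ {j k} → j ≤ k → AtMost j P → AtMost k P
    atMost-≤ j≤k atMost u ps = ≤-trans (atMost u ps) j≤k

    atMost-split : ∀ {Q : A → Set} {a b} → Decidable Q →
      AtMost a (λ x → P x × Q x) → AtMost b (λ x → P x × ¬ Q x) → AtMost (a + b) P
    atMost-split {Q} Q? atMostQ atMost¬Q {xs} u ps = ≤-trans (split xs) (+-mono-≤
      (atMostQ (Unique.filter⁺ Q? u) (All.zip (All-filter⁺ Q? ps , all-filter Q? xs)))
      (atMost¬Q (Unique.filter⁺ (¬? ∘ Q?) u) (All.zip (All-filter⁺ (¬? ∘ Q?) ps , all-filter (¬? ∘ Q?) xs))))
      where
      split : ∀ xs → length xs ≤ length (filter Q? xs) + length (filter (¬? ∘ Q?) xs)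
      split [] = z≤n
      split (x ∷ xs) with Q? x
      ... | yes _ = s≤s (split xs)
      ... | no _ = ≤-trans (s≤s (split xs)) (≤-reflexive (sym (+-suc _ _)))

  atMost-≡ : ∀ {A : Set} {c : A} → AtMost 1 (_≡ c)
  atMost-≡ {xs = []} _ _ = z≤n
  atMost-≡ {xs = _ ∷ []} _ _ = s≤s z≤n
  atMost-≡ {xs = _ ∷ _ ∷ _} ((x≢y ∷ _) ∷ _) (refl ∷ refl ∷ _) = ⊥-elim (x≢y refl)

  module _ {A B : Set} {P : A → Set} (f : A → B) (f-injective : ∀ {x y} → P x → P y → f x ≡ f y → x ≡ y) where

    Unique-map⁺-on : ∀ {xs} → Unique xs → All P xs → Unique (map f xs)
    Unique-map⁺-on [] [] = []
    Unique-map⁺-on {x ∷ _} (x∉xs ∷ xs!) (px ∷ ps) = fx∉fxs x∉xs ps ∷ Unique-map⁺-on xs! ps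
      where
      fx∉fxs : ∀ {ys} → All (x ≢_) ys → All P ys → All (f x ≢_) (map f ys)
      fx∉fxs [] [] = []
      fx∉fxs (x≢y ∷ x≢ys) (py ∷ pys) = (λ fx≡fy → x≢y (f-injective px py fx≡fy)) ∷ fx∉fxs x≢ys pys

    atMost-injective : ∀ {Q : B → Set} {k} → (∀ {x} → P x → Q (f x)) → AtMost k Q → AtMost k P
    atMost-injective P⇒Q atMost {xs} u ps =
      subst (_≤ _) (length-map f xs) (atMost (Unique-map⁺-on u ps) (All-map⁺ (All.map P⇒Q ps)))

  module _ {K : Set} where

    sum-map-mono-≤ : ∀ (g h : K → ℕ) {ks} → All (λ k → g k ≤ h k) ks → sum (map g ks) ≤ sum (map h ks)
    sum-map-mono-≤ g h [] = z≤n
    sum-map-mono-≤ g h (g≤h ∷ gs≤hs) = +-mono-≤ g≤h (sum-map-mono-≤ g h gs≤hs)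

    sum-map-*ˡ : ∀ c (g : K → ℕ) ks → sum (map (λ k → c * g k) ks) ≡ c * sum (map g ks)
    sum-map-*ˡ c g [] = sym (*-zeroʳ c)
    sum-map-*ˡ c g (k ∷ ks) = trans (cong (c * g k +_) (sum-map-*ˡ c g ks)) (sym (*-distribˡ-+ c (g k) _))

    sum-map-const : ∀ c (ks : List K) → sum (map (λ _ → c) ks) ≡ length ks * c
    sum-map-const c [] = refl
    sum-map-const c (k ∷ ks) = cong (c +_) (sum-map-const c ks)

  module Fibres {A K : Set} (_≟_ : DecidableEquality K) (f : A → K) where

    fibre : List A → K → List A
    fibre xs k = filter (λ x → f x ≟ k) xs

    keys : List A → List K
    keys xs = deduplicate _≟_ (map f xs)

    keys-unique : ∀ xs → Unique (keys xs)
    keys-unique xs = deduplicate-! _≟_ (map f xs)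

    ∈-keys⁻ : ∀ xs {k} → k ∈ keys xs → ∃[ x ] (x ∈ xs × k ≡ f x)
    ∈-keys⁻ xs k∈ = ∈-map⁻ f (∈-deduplicate⁻ _≟_ (map f xs) k∈)

    fibre-unique : ∀ {xs} k → Unique xs → Unique (fibre xs k)
    fibre-unique k = Unique.filter⁺ (λ x → f x ≟ k)

    fibre-all : ∀ {P : A → Set} {xs} k → All P xs → All (λ x → P x × f x ≡ k) (fibre xs k)
    fibre-all {xs = xs} k ps = All.zip (All-filter⁺ (λ x → f x ≟ k) ps , all-filter (λ x → f x ≟ k) xs)

    private
      sum-fibres-∷ : ∀ x xs ks → sum (map (length ∘ fibre xs) ks) ≤ sum (map (length ∘ fibre (x ∷ xs)) ks)
      sum-fibres-∷ x xs [] = z≤n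
      sum-fibres-∷ x xs (k ∷ ks) with f x ≟ k
      ... | yes _ = +-mono-≤ (n≤1+n _) (sum-fibres-∷ x xs ks)
      ... | no _ = +-monoʳ-≤ _ (sum-fibres-∷ x xs ks)

      sum-fibres-∈ : ∀ x xs {ks} → f x ∈ ks →
        suc (sum (map (length ∘ fibre xs) ks)) ≤ sum (map (length ∘ fibre (x ∷ xs)) ks)
      sum-fibres-∈ x xs {k ∷ ks} (here fx≡k) with f x ≟ k
      ... | yes _ = s≤s (+-monoʳ-≤ _ (sum-fibres-∷ x xs ks))
      ... | no fx≢k = ⊥-elim (fx≢k fx≡k)
      sum-fibres-∈ x xs {k ∷ ks} (there fx∈ks) with f x ≟ k
      ... | yes _ = s≤s (+-monoʳ-≤ _ (sum-fibres-∷ x xs ks))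
      ... | no _ = ≤-trans (≤-reflexive (sym (+-suc _ _))) (+-monoʳ-≤ _ (sum-fibres-∈ x xs fx∈ks))

    length≤sum-fibres : ∀ ks xs → All (λ x → f x ∈ ks) xs → length xs ≤ sum (map (length ∘ fibre xs) ks)
    length≤sum-fibres ks [] [] = z≤n
    length≤sum-fibres ks (x ∷ xs) (fx∈ks ∷ fxs∈ks) =
      ≤-trans (s≤s (length≤sum-fibres ks xs fxs∈ks)) (sum-fibres-∈ x xs fx∈ks)

    length≤sum-fibres-keys : ∀ xs → length xs ≤ sum (map (length ∘ fibre xs) (keys xs))
    length≤sum-fibres-keys xs = length≤sum-fibres (keys xs) xs (All.tabulate (∈-deduplicate⁺ _≟_ ∘ ∈-map⁺ f))

    atMost-fibres : ∀ {P : A → Set} {Q : K → Set} {a c} → AtMost a Q → (∀ {x} → P x → Q (f x)) →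
      (∀ {k} → Q k → AtMost c (λ x → P x × f x ≡ k)) → AtMost (a * c) P
    atMost-fibres {Q = Q} {a} {c} atMostQ P⇒Q atMostFibre {xs} u ps = begin
      length xs                                ≤⟨ length≤sum-fibres-keys xs ⟩
      sum (map (length ∘ fibre xs) (keys xs))  ≤⟨ sum-map-mono-≤ (length ∘ fibre xs) (λ _ → c) (All.tabulate fibre≤c) ⟩
      sum (map (λ _ → c) (keys xs))            ≡⟨ sum-map-const c (keys xs) ⟩
      length (keys xs) * c                     ≤⟨ *-monoˡ-≤ c (atMostQ (keys-unique xs) (All.tabulate keys-Q)) ⟩
      a * c                                    ∎
      where
      open ≤-Reasoning
      keys-Q : ∀ {k} → k ∈ keys xs → Q k
      keys-Q k∈ with ∈-keys⁻ xs k∈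
      ... | x , x∈xs , refl = P⇒Q (All.lookup ps x∈xs)
      fibre≤c : ∀ {k} → k ∈ keys xs → length (fibre xs k) ≤ c
      fibre≤c {k} k∈ = atMostFibre (keys-Q k∈) (fibre-unique k u) (fibre-all k ps)

  module _ {K V : Set} where

    graph : (K → List V) → List K → List (K × V)
    graph g = concatMap (λ k → map (k ,_) (g k))

    length-graph : ∀ g ks → length (graph g ks) ≡ sum (map (length ∘ g) ks)
    length-graph g [] = refl
    length-graph g (k ∷ ks) = trans (length-++ (map (k ,_) (g k))) (cong₂ _+_ (length-map (k ,_) (g k)) (length-graph g ks))

    ∈-graph⁻ : ∀ g ks {k v} → (k , v) ∈ graph g ks → k ∈ ks × v ∈ g k
    ∈-graph⁻ g (k′ ∷ ks) kv∈ with ∈-++⁻ (map (k′ ,_) (g k′)) kv∈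
    ... | inj₁ kv∈k′ with ∈-map⁻ (k′ ,_) kv∈k′
    ...   | v , v∈ , refl = here refl , v∈
    ∈-graph⁻ g (k′ ∷ ks) kv∈ | inj₂ kv∈ks = Product.map₁ there (∈-graph⁻ g ks kv∈ks)

    graph-unique : ∀ g {ks} → Unique ks → All (Unique ∘ g) ks → Unique (graph g ks)
    graph-unique g {[]} [] [] = []
    graph-unique g {k ∷ ks} (k∉ks ∷ ks!) (gk! ∷ gks!) =
      Unique.++⁺ (Unique.map⁺ (cong proj₂) gk!) (graph-unique g ks! gks!) disjoint
      where
      disjoint : ∀ {kv} → ¬ (kv ∈ map (k ,_) (g k) × kv ∈ graph g ks)
      disjoint (kv∈k , kv∈ks) with ∈-map⁻ (k ,_) kv∈k
      ... | v , _ , refl = All.lookup k∉ks (proj₁ (∈-graph⁻ g ks kv∈ks)) refl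


module Covers where

  open Counting
  open import Data.Nat using (suc; _+_; _∸_; _≤_; s≤s; z≤n)
  open import Data.Nat.Properties
  open import Data.Bool using (Bool)
  import Data.Bool.Properties as Bool
  open import Data.Fin using (zero)
  open import Data.Fin.Subset using (Subset; _⊆_; ∣_∣; inside; outside)
  open import Data.Fin.Subset.Properties using (⊆-trans; drop-∷-⊆; p⊆q⇒∣p∣≤∣q∣)
  open import Data.Vec using (Vec; []; _∷_; lookup; tail)
  open import Data.Vec.Base using () renaming (here to here[]=)
  open import Data.List using ([])
  open import Data.List.Relation.Unary.All using (_∷_)
  open import Data.List.Relation.Unary.Unique.Propositional using (_∷_)
  open import Data.Product using (_×_; _,_; proj₁; proj₂)
  open import Data.Empty using (⊥-elim)
  open import Function using (id; case_of_)
  open import Relation.Binary.PropositionalEquality using (_≡_; _≢_; refl; sym; trans; cong)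

  tail-injective : ∀ {X : Set} {k} {x : X} {v v′ : Vec X (suc k)} →
    lookup v zero ≡ x → lookup v′ zero ≡ x → tail v ≡ tail v′ → v ≡ v′
  tail-injective {v = _ ∷ _} {_ ∷ _} refl refl refl = refl

  p⊆q∧∣q∣≤∣p∣⇒p≡q : ∀ {n} {p q : Subset n} → p ⊆ q → ∣ q ∣ ≤ ∣ p ∣ → p ≡ q
  p⊆q∧∣q∣≤∣p∣⇒p≡q {p = []} {[]} _ _ = refl
  p⊆q∧∣q∣≤∣p∣⇒p≡q {p = outside ∷ p} {outside ∷ q} p⊆q ∣q∣≤∣p∣ =
    cong (outside ∷_) (p⊆q∧∣q∣≤∣p∣⇒p≡q (drop-∷-⊆ p⊆q) ∣q∣≤∣p∣)
  p⊆q∧∣q∣≤∣p∣⇒p≡q {p = inside ∷ p} {inside ∷ q} p⊆q (s≤s ∣q∣≤∣p∣) =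
    cong (inside ∷_) (p⊆q∧∣q∣≤∣p∣⇒p≡q (drop-∷-⊆ p⊆q) ∣q∣≤∣p∣)
  p⊆q∧∣q∣≤∣p∣⇒p≡q {p = outside ∷ p} {inside ∷ q} p⊆q ∣q∣≤∣p∣ =
    ⊥-elim (<⇒≱ (s≤s (p⊆q⇒∣p∣≤∣q∣ (drop-∷-⊆ p⊆q))) ∣q∣≤∣p∣)
  p⊆q∧∣q∣≤∣p∣⇒p≡q {p = inside ∷ p} {outside ∷ q} p⊆q _ with p⊆q here[]=
  ... | ()

  Cover : ∀ {n} → Subset n → Subset n → Subset n → Set
  Cover A C Y = A ⊆ Y × Y ⊆ C × ∣ Y ∣ ≡ suc ∣ A ∣

  module _ {n} {a c : Bool} {A C : Subset n} where

    cover-tail : ∀ {Y} → Cover (a ∷ A) (c ∷ C) (a ∷ Y) → Cover A C Y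
    cover-tail {Y} (A⊆Y , Y⊆C , ∣Y∣≡) = drop-∷-⊆ A⊆Y , drop-∷-⊆ Y⊆C , size a ∣Y∣≡
      where
      size : ∀ b → ∣ b ∷ Y ∣ ≡ suc ∣ b ∷ A ∣ → ∣ Y ∣ ≡ suc ∣ A ∣
      size outside = id
      size inside = suc-injective

    atMost-covers-∷ : ∀ {k b} → AtMost k (Cover A C) → AtMost b (λ Y → Cover (a ∷ A) (c ∷ C) Y × lookup Y zero ≢ a) →
      AtMost (k + b) (Cover (a ∷ A) (c ∷ C))
    atMost-covers-∷ atMost-tails = atMost-split (λ Y → lookup Y zero Bool.≟ a)
      (atMost-injective tail (λ (_ , a≡) (_ , a≡′) → tail-injective a≡ a≡′)
        (λ { {_ ∷ _} (cover , refl) → cover-tail cover }) atMost-tails)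

  cover-new-head : ∀ {n} {a c : Bool} {A C : Subset n} {Y} →
    Cover (a ∷ A) (c ∷ C) Y → lookup Y zero ≢ a → a ≡ outside × c ≡ inside × Y ≡ inside ∷ A
  cover-new-head {a = inside} {Y = inside ∷ _} _ inside≢a = ⊥-elim (inside≢a refl)
  cover-new-head {a = inside} {Y = outside ∷ _} (A⊆Y , _) _ with A⊆Y here[]=
  ... | ()
  cover-new-head {a = outside} {Y = outside ∷ _} _ outside≢a = ⊥-elim (outside≢a refl)
  cover-new-head {a = outside} {outside} {Y = inside ∷ _} (_ , Y⊆C , _) _ with Y⊆C here[]=
  ... | ()
  cover-new-head {a = outside} {inside} {Y = inside ∷ _} (A⊆Y , _ , ∣Y∣≡) _ =
    refl , refl , cong (inside ∷_) (sym (p⊆q∧∣q∣≤∣p∣⇒p≡q (drop-∷-⊆ A⊆Y) (≤-reflexive (suc-injective ∣Y∣≡))))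

  atMost-covers-⊆ : ∀ {n} {A C : Subset n} → A ⊆ C → AtMost (∣ C ∣ ∸ ∣ A ∣) (Cover A C)
  atMost-covers-⊆ {A = []} {[]} _ = atMost-∅ λ { {[]} (_ , _ , ()) }
  atMost-covers-⊆ {A = outside ∷ A} {inside ∷ C} A⊆C =
    atMost-≤ (≤-reflexive (trans (+-comm _ 1) (sym (+-∸-assoc 1 (p⊆q⇒∣p∣≤∣q∣ (drop-∷-⊆ A⊆C))))))
      (atMost-covers-∷ (atMost-covers-⊆ (drop-∷-⊆ A⊆C))
        (atMost-mono (λ (cover , new) → proj₂ (proj₂ (cover-new-head cover new))) atMost-≡))
  atMost-covers-⊆ {A = outside ∷ A} {outside ∷ C} A⊆C =
    atMost-≤ (≤-reflexive (+-identityʳ _))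
      (atMost-covers-∷ (atMost-covers-⊆ (drop-∷-⊆ A⊆C))
        (atMost-∅ (λ (cover , new) → case proj₁ (proj₂ (cover-new-head cover new)) of λ ())))
  atMost-covers-⊆ {A = inside ∷ A} {inside ∷ C} A⊆C =
    atMost-≤ (≤-reflexive (+-identityʳ _))
      (atMost-covers-∷ (atMost-covers-⊆ (drop-∷-⊆ A⊆C))
        (atMost-∅ (λ (cover , new) → case proj₁ (cover-new-head cover new) of λ ())))
  atMost-covers-⊆ {A = inside ∷ A} {outside ∷ C} A⊆C with A⊆C here[]=
  ... | ()

  atMost-covers : ∀ {n} {A C : Subset n} → AtMost (∣ C ∣ ∸ ∣ A ∣) (Cover A C)
  atMost-covers {xs = []} _ _ = z≤n
  atMost-covers covers!@(_ ∷ _) covers@((A⊆Y , Y⊆C , _) ∷ _) = atMost-covers-⊆ (⊆-trans A⊆Y Y⊆C) covers! covers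

module Chains where

  open Counting
  open Fibres using (atMost-fibres)
  open Covers
  open import Data.Nat using (ℕ; zero; suc; _+_; _*_; _∸_; _≤_; s≤s; _!)
  open import Data.Nat.Properties
  open import Data.Fin using (Fin; zero; suc; inject₁; fromℕ)
  open import Data.Fin.Subset using (Subset; ⊥; _⊆_; _⊂_; ∣_∣)
  open import Data.Fin.Subset.Properties using (⊂-trans; p⊂q⇒∣p∣<∣q∣; p⊂q⇒p⊆q; ∣⊥∣≡0; ∣⊤∣≡n; ∣p∣≤n)
  open import Data.Vec using (Vec; []; _∷_; lookup; tail; toList)
  open import Data.Vec.Relation.Unary.Any using (here; there)
  open import Data.Vec.Membership.Propositional using () renaming (_∈_ to _∈ᵥ_)
  open import Data.Vec.Membership.Propositional.Properties using (∈-toList⁺; ∈-lookup)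
  open import Data.List.Relation.Unary.All as All using ([]; _∷_)
  open import Data.List.Relation.Unary.AllPairs using (AllPairs; []; _∷_)
  open import Data.Product using (_×_; _,_; proj₁)
  open import Data.Empty using (⊥-elim)
  open import Function using (_∘_; id)
  open import Relation.Binary.PropositionalEquality using (_≡_; _≢_; refl; sym; trans; cong; subst)

  module _ {n : ℕ} where

    Steps : ∀ {m} → Vec (Subset n) (suc m) → Set
    Steps {m} v = (i : Fin m) → lookup v (inject₁ i) ⊂ lookup v (suc i)

    Segment : ∀ {m} → Subset n → Subset n → Vec (Subset n) (suc m) → Set
    Segment {m} A B v = lookup v zero ≡ A × lookup v (fromℕ m) ≡ B × Steps v

    steps⇒increasing : ∀ {m} (v : Vec (Subset n) (suc m)) → Steps v → AllPairs _⊂_ (toList v)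
    steps⇒increasing (x ∷ []) _ = [] ∷ []
    steps⇒increasing (x ∷ y ∷ w) steps with steps⇒increasing (y ∷ w) (steps ∘ suc)
    ... | y⊂w ∷ increasing = (steps zero ∷ All.map (⊂-trans (steps zero)) y⊂w) ∷ y⊂w ∷ increasing

    head-⊆ : ∀ {m} {v : Vec (Subset n) (suc m)} {F} → Steps v → F ∈ᵥ v → lookup v zero ⊆ F
    head-⊆ _ (here refl) = id
    head-⊆ {v = x ∷ w} steps (there F∈w) with steps⇒increasing (x ∷ w) steps
    ... | x⊂w ∷ _ = p⊂q⇒p⊆q (All.lookup x⊂w (∈-toList⁺ F∈w))

    size-growth : ∀ {m} (v : Vec (Subset n) (suc m)) → Steps v → m + ∣ lookup v zero ∣ ≤ ∣ lookup v (fromℕ m) ∣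
    size-growth (x ∷ []) _ = ≤-refl
    size-growth {suc m} (x ∷ y ∷ w) steps = begin
      suc m + ∣ x ∣              ≡⟨ +-suc m ∣ x ∣ ⟨
      m + suc ∣ x ∣              ≤⟨ +-monoʳ-≤ m (p⊂q⇒∣p∣<∣q∣ (steps zero)) ⟩
      m + ∣ y ∣                  ≤⟨ size-growth (y ∷ w) (steps ∘ suc) ⟩
      ∣ lookup (y ∷ w) (fromℕ m) ∣ ∎
      where open ≤-Reasoning

    second : ∀ {m} → Vec (Subset n) (suc (suc m)) → Subset n
    second v = lookup v (suc zero)

    segment-tail : ∀ {m A B Y x} {w : Vec (Subset n) (suc m)} → Segment A B (x ∷ w) → lookup w zero ≡ Y → Segment Y B w
    segment-tail (_ , B-end , steps) Y-second = Y-second , B-end , steps ∘ suc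

    second-cover : ∀ {m A B} {v : Vec (Subset n) (suc (suc m))} →
      ∣ B ∣ ≡ suc m + ∣ A ∣ → Segment A B v → Cover A B (second v)
    second-cover {m} {A} {B} {x ∷ w} ∣B∣≡ (refl , B-end , steps) =
      p⊂q⇒p⊆q (steps zero) , subst (_ ⊆_) B-end (head-⊆ (steps ∘ suc) (∈-lookup (fromℕ m) w)) ,
      ≤-antisym (+-cancelˡ-≤ m _ _ m+∣Y∣≤m+1+∣A∣) (p⊂q⇒∣p∣<∣q∣ (steps zero))
      where
      open ≤-Reasoning
      m+∣Y∣≤m+1+∣A∣ : m + ∣ lookup w zero ∣ ≤ m + suc ∣ A ∣
      m+∣Y∣≤m+1+∣A∣ = begin
        m + ∣ lookup w zero ∣    ≤⟨ size-growth w (steps ∘ suc) ⟩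
        ∣ lookup w (fromℕ m) ∣   ≡⟨ cong ∣_∣ B-end ⟩
        ∣ B ∣                    ≡⟨ ∣B∣≡ ⟩
        suc m + ∣ A ∣            ≡⟨ +-suc m ∣ A ∣ ⟨
        m + suc ∣ A ∣            ∎

    x≡1+k+a∧y≡1+a⇒x≡k+y : ∀ {k x y a : ℕ} → x ≡ suc k + a → y ≡ suc a → x ≡ k + y
    x≡1+k+a∧y≡1+a⇒x≡k+y {k} {a = a} x≡ refl = trans x≡ (sym (+-suc k a))

    atMost-segments : ∀ m {A B : Subset n} → ∣ B ∣ ≡ m + ∣ A ∣ → AtMost (m !) (Segment {m} A B)
    atMost-segments zero _ = atMost-mono (λ { {_ ∷ []} (refl , _) → refl }) atMost-≡
    atMost-segments (suc m) {A} {B} ∣B∣≡ =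
      atMost-≤ (≤-reflexive (cong (_* m !) (trans (cong (_∸ ∣ A ∣) ∣B∣≡) (m+n∸n≡m (suc m) ∣ A ∣))))
        (atMost-fibres _≟S_ second (atMost-covers {A = A} {B}) (λ {v} → second-cover {v = v} ∣B∣≡) fibre)
      where
      fibre : ∀ {Y} → Cover A B Y → AtMost (m !) (λ v → Segment A B v × second v ≡ Y)
      fibre (_ , _ , ∣Y∣≡) =
        atMost-injective tail (λ ((A-start , _) , _) ((A-start′ , _) , _) → tail-injective A-start A-start′)
          (λ { {_ ∷ _} (segment , Y-second) → segment-tail segment Y-second })
          (atMost-segments m (x≡1+k+a∧y≡1+a⇒x≡k+y ∣B∣≡ ∣Y∣≡))

    atMost-segments-through : ∀ m r {A F B : Subset n} → r ≤ m → ∣ F ∣ ≡ r + ∣ A ∣ → ∣ B ∣ ≡ m + ∣ A ∣ →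
      AtMost (r ! * (m ∸ r) !) (λ v → Segment {m} A B v × F ∈ᵥ v)
    atMost-segments-through m zero _ _ ∣B∣≡ =
      atMost-≤ (≤-reflexive (sym (+-identityʳ (m !)))) (atMost-mono proj₁ (atMost-segments m ∣B∣≡))
    atMost-segments-through (suc m) (suc r) {A} {F} {B} (s≤s r≤m) ∣F∣≡ ∣B∣≡ =
      atMost-≤ (≤-reflexive (trans (cong (_* (r ! * (m ∸ r) !)) ∣F∣∸∣A∣≡) (sym (*-assoc (suc r) (r !) _))))
        (atMost-fibres _≟S_ second (atMost-covers {A = A} {F}) second-cover-F fibre)
      where
      ∣F∣∸∣A∣≡ : ∣ F ∣ ∸ ∣ A ∣ ≡ suc r
      ∣F∣∸∣A∣≡ = trans (cong (_∸ ∣ A ∣) ∣F∣≡) (m+n∸n≡m (suc r) ∣ A ∣)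
      F≢A : F ≢ A
      F≢A refl = m≢1+n+m ∣ A ∣ ∣F∣≡
      second-cover-F : ∀ {v} → Segment A B v × F ∈ᵥ v → Cover A F (second v)
      second-cover-F {_ ∷ _} ((refl , _) , here F≡A) = ⊥-elim (F≢A F≡A)
      second-cover-F {v@(_ ∷ _)} (segment@(refl , _ , steps) , there F∈w) =
        let A⊆Y , _ , ∣Y∣≡ = second-cover {v = v} ∣B∣≡ segment in A⊆Y , head-⊆ (steps ∘ suc) F∈w , ∣Y∣≡
      fibre : ∀ {Y} → Cover A F Y → AtMost (r ! * (m ∸ r) !) (λ v → (Segment A B v × F ∈ᵥ v) × second v ≡ Y)
      fibre (_ , _ , ∣Y∣≡) =
        atMost-injective tail (λ (((A-start , _) , _) , _) (((A-start′ , _) , _) , _) → tail-injective A-start A-start′)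
          (λ { {_ ∷ _} (((refl , _) , here F≡A) , _) → ⊥-elim (F≢A F≡A)
             ; {_ ∷ _} ((segment , there F∈w) , Y-second) → segment-tail segment Y-second , F∈w })
          (atMost-segments-through m r r≤m (x≡1+k+a∧y≡1+a⇒x≡k+y ∣F∣≡ ∣Y∣≡) (x≡1+k+a∧y≡1+a⇒x≡k+y ∣B∣≡ ∣Y∣≡))

  -- IsFullChain χ unfolds to Segment ⊥ ⊤ χ.
  atMost-fullChains-through : ∀ {n} (F : Subset n) →
    AtMost (∣ F ∣ ! * (n ∸ ∣ F ∣) !) (λ χ → IsFullChain χ × F ∈χ χ)
  atMost-fullChains-through {n} F =
    atMost-segments-through n ∣ F ∣ (∣p∣≤n F) (sym (+-∣⊥∣ ∣ F ∣)) (trans (∣⊤∣≡n n) (sym (+-∣⊥∣ n)))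
    where
    +-∣⊥∣ : ∀ k → k + ∣ ⊥ {n} ∣ ≡ k
    +-∣⊥∣ k = trans (cong (k +_) (∣⊥∣≡0 n)) (+-identityʳ k)


module Binomials where

  open import Data.Nat using (_*_; _∸_; _≤_; _!)
  open import Data.Nat.Properties
  open import Data.Nat.Combinatorics using (_C_; nCk≡n!/k![n-k]!)
  open import Data.Nat.DivMod using (m/n*n≤m)
  open import Data.Fin.Subset using (Subset; ∣_∣)
  open import Data.List using (List; []; _∷_)
  open import Data.List.Membership.Propositional using (_∈_)
  open import Data.List.Relation.Unary.Any using (here; there)
  open import Relation.Binary.PropositionalEquality using (refl; sym; subst)

  minBinom≤ : ∀ {n} {𝓕 : List (Subset n)} {F} → F ∈ 𝓕 → minBinom n 𝓕 ≤ n C ∣ F ∣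
  minBinom≤ {𝓕 = _ ∷ []} (here refl) = ≤-refl
  minBinom≤ {𝓕 = _ ∷ _ ∷ _} (here refl) = m⊓n≤m _ _
  minBinom≤ {𝓕 = _ ∷ _ ∷ _} (there F∈𝓕) = ≤-trans (m⊓n≤n _ _) (minBinom≤ F∈𝓕)

  nCk*k!*[n∸k]!≤n! : ∀ n k → k ≤ n → (n C k) * (k ! * (n ∸ k) !) ≤ n !
  nCk*k!*[n∸k]!≤n! n k k≤n = subst (λ c → c * (k ! * (n ∸ k) !) ≤ n !) (sym (nCk≡n!/k![n-k]! k≤n))
    (m/n*n≤m (n !) (k ! * (n ∸ k) !) {{k !* (n ∸ k) !≢0}})

module Windows where

  open import Data.Nat using (zero; suc; _+_; _*_; _≤_; _<_; z≤n; s≤s; NonZero; >-nonZero)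
  open import Data.Nat.Properties
  open import Data.Fin using (Fin; zero; suc; toℕ)
  open import Data.Vec using (Vec; []; _∷_; lookup)
  open import Data.List using (List; []; _∷_; length; map; drop; reverse)
  open import Data.List.Properties using (unfold-reverse)
  open import Data.List.Membership.Propositional using (_∈_)
  open import Data.List.Relation.Unary.All as All using ([]; _∷_)
  open import Data.List.Relation.Unary.Any using (here; there)
  import Data.List.Relation.Unary.Any.Properties as Any
  open import Data.List.Relation.Unary.AllPairs using (AllPairs; []; _∷_)
  import Data.List.Relation.Unary.AllPairs.Properties as AllPairs
  open import Data.List.Relation.Binary.Sublist.Heterogeneous using (Sublist; []; _∷_; _∷ʳ_; minimum)
  open import Data.List.Relation.Binary.Sublist.Propositional.Properties using (All-resp-⊆)
  open import Function using (flip)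
  open import Relation.Nullary using (yes; no; contradiction)
  open import Relation.Binary.PropositionalEquality using (_≡_; refl; sym; subst)

  module _ {X : Set} where

    AllPairs-resp-Sublist : ∀ {R : X → X → Set} {xs ys} → Sublist _≡_ xs ys → AllPairs R ys → AllPairs R xs
    AllPairs-resp-Sublist [] [] = []
    AllPairs-resp-Sublist (_ ∷ʳ xs⊑ys) (_ ∷ R-ys) = AllPairs-resp-Sublist xs⊑ys R-ys
    AllPairs-resp-Sublist (refl ∷ xs⊑ys) (R-y ∷ R-ys) = All-resp-⊆ xs⊑ys R-y ∷ AllPairs-resp-Sublist xs⊑ys R-ys

    AllPairs-reverse⁺ : ∀ {R : X → X → Set} {xs} → AllPairs R xs → AllPairs (flip R) (reverse xs)
    AllPairs-reverse⁺ {xs = []} [] = []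
    AllPairs-reverse⁺ {R = R} {x ∷ xs} (R-x ∷ R-xs) = subst (AllPairs (flip R)) (sym (unfold-reverse x xs))
      (AllPairs.++⁺ (AllPairs-reverse⁺ R-xs) ([] ∷ []) (All.tabulate λ y∈ → All.lookup R-x (Any.reverse⁻ y∈) ∷ []))

    Sorted : ∀ {q} → (X → X → Set) → Vec X q → Set
    Sorted R w = ∀ j k → toℕ j < toℕ k → R (lookup w j) (lookup w k)

    prefix : ∀ q (xs : List X) → q ≤ length xs → Vec X q
    prefix zero _ _ = []
    prefix (suc q) (x ∷ xs) (s≤s q≤) = x ∷ prefix q xs q≤

    windows : ∀ q → List X → List (Vec X q)
    windows q [] = []
    windows q (x ∷ xs) with q ≤? length (x ∷ xs)
    ... | yes q≤ = prefix q (x ∷ xs) q≤ ∷ windows q xs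
    ... | no _ = []

    ∈-prefix : ∀ q xs q≤ (j : Fin q) → lookup (prefix q xs q≤) j ∈ xs
    ∈-prefix (suc q) (x ∷ xs) (s≤s _) zero = here refl
    ∈-prefix (suc q) (x ∷ xs) (s≤s q≤) (suc j) = there (∈-prefix q xs q≤ j)

    ∈-windows⁻ : ∀ q xs {w} → w ∈ windows q xs → (j : Fin q) → lookup w j ∈ xs
    ∈-windows⁻ q (x ∷ xs) w∈ j with q ≤? length (x ∷ xs)
    ∈-windows⁻ q (x ∷ xs) (here refl) j | yes q≤ = ∈-prefix q (x ∷ xs) q≤ j
    ∈-windows⁻ q (x ∷ xs) (there w∈) j | yes _ = there (∈-windows⁻ q xs w∈ j)

    prefix-sorted : ∀ {R} q xs q≤ → AllPairs R xs → Sorted R (prefix q xs q≤)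
    prefix-sorted (suc q) (x ∷ xs) (s≤s q≤) (R-x ∷ _) zero (suc k) _ = All.lookup R-x (∈-prefix q xs q≤ k)
    prefix-sorted (suc q) (x ∷ xs) (s≤s q≤) (_ ∷ R-xs) (suc j) (suc k) (s≤s j<k) = prefix-sorted q xs q≤ R-xs j k j<k

    windows-sorted : ∀ {R} q xs {w} → AllPairs R xs → w ∈ windows q xs → Sorted R w
    windows-sorted q (x ∷ xs) R-xs w∈ with q ≤? length (x ∷ xs)
    windows-sorted q (x ∷ xs) R-xs (here refl) | yes q≤ = prefix-sorted q (x ∷ xs) q≤ R-xs
    windows-sorted q (x ∷ xs) (_ ∷ R-xs) (there w∈) | yes _ = windows-sorted q xs R-xs w∈

    length≤windows+ : ∀ q xs → length xs ≤ length (windows (suc q) xs) + q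
    length≤windows+ q [] = z≤n
    length≤windows+ q (x ∷ xs) with suc q ≤? length (x ∷ xs)
    ... | yes _ = s≤s (length≤windows+ q xs)
    ... | no q≰ = ≤-pred (≰⇒> q≰)

    windows-nonempty : ∀ q .{{_ : NonZero q}} xs → q ≤ length xs → 1 ≤ length (windows q xs)
    windows-nonempty (suc q) (x ∷ xs) q≤ with suc q ≤? length (x ∷ xs)
    ... | yes _ = s≤s z≤n
    ... | no q≰ = contradiction q≤ q≰

    length≤q*windows : ∀ q .{{_ : NonZero q}} xs → q ≤ length xs → length xs ≤ q * length (windows q xs)
    length≤q*windows (suc q) xs q≤∣xs∣ = begin
      length xs             ≤⟨ length≤windows+ q xs ⟩
      W + q                 ≤⟨ +-monoʳ-≤ W (m≤m*n q W {{>-nonZero (windows-nonempty (suc q) xs q≤∣xs∣)}}) ⟩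
      W + q * W             ∎
      where
      open ≤-Reasoning
      W = length (windows (suc q) xs)

    drop-prefix : ∀ q xs q≤ (i : Fin q) → drop (toℕ i) xs ≡ lookup (prefix q xs q≤) i ∷ drop (suc (toℕ i)) xs
    drop-prefix (suc q) (x ∷ xs) (s≤s _) zero = refl
    drop-prefix (suc q) (x ∷ xs) (s≤s q≤) (suc i) = drop-prefix q xs q≤ i

    column-sublist-drop : ∀ q (i : Fin q) xs → Sublist _≡_ (map (λ w → lookup w i) (windows q xs)) (drop (toℕ i) xs)
    column-sublist-drop q i [] = minimum _
    column-sublist-drop q i (x ∷ xs) with q ≤? length (x ∷ xs)
    ... | yes q≤ rewrite drop-prefix q (x ∷ xs) q≤ i = refl ∷ column-sublist-drop q i xs
    ... | no _ = minimum _

    column-pairwise : ∀ {R} q (i : Fin q) {xs} → AllPairs R xs → AllPairs R (map (λ w → lookup w i) (windows q xs))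
    column-pairwise q i {xs} R-xs = AllPairs-resp-Sublist (column-sublist-drop q i xs) (AllPairs.drop⁺ (toℕ i) R-xs)


module Rescaling where

  open import Data.Nat as ℕ using (suc)
  import Data.Nat.Properties as ℕ
  open import Data.Nat.Coprimality using (1-coprimeTo) renaming (sym to coprime-sym)
  open import Data.Integer as ℤ using (+_; +≤+)
  import Data.Integer.Properties as ℤ
  open import Data.Rational
  open import Data.Rational.Properties
  open import Data.Rational.Unnormalised as ℚᵘ using (*≡*)
  import Data.Rational.Unnormalised.Properties as ℚᵘ
  open import Data.Rational.Solver using (module +-*-Solver)
  open import Relation.Binary.PropositionalEquality using (_≡_; refl; trans; cong)

  ℕ→ℚ≡mkℚ : ∀ m → ℕ→ℚ m ≡ mkℚ (+ m) 0 (coprime-sym (1-coprimeTo m))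
  ℕ→ℚ≡mkℚ m = normalize-coprime (coprime-sym (1-coprimeTo m))

  ℕ→ℚ-mono-≤ : ∀ {m n} → m ℕ.≤ n → ℕ→ℚ m ≤ ℕ→ℚ n
  ℕ→ℚ-mono-≤ {m} {n} m≤n rewrite ℕ→ℚ≡mkℚ m | ℕ→ℚ≡mkℚ n = *≤* (ℤ.*-monoʳ-≤-nonNeg (+ 1) (+≤+ m≤n))

  ℕ→ℚ-homo-* : ∀ m n → ℕ→ℚ (m ℕ.* n) ≡ ℕ→ℚ m * ℕ→ℚ n
  ℕ→ℚ-homo-* m n = toℚᵘ-injective (ℚᵘ.≃-trans homo (ℚᵘ.≃-sym (toℚᵘ-homo-* (ℕ→ℚ m) (ℕ→ℚ n))))
    where
    homo : toℚᵘ (ℕ→ℚ (m ℕ.* n)) ℚᵘ.≃ toℚᵘ (ℕ→ℚ m) ℚᵘ.* toℚᵘ (ℕ→ℚ n)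
    homo rewrite ℕ→ℚ≡mkℚ (m ℕ.* n) | ℕ→ℚ≡mkℚ m | ℕ→ℚ≡mkℚ n = *≡* (cong (ℤ._* + 1) (ℤ.pos-* m n))

  1/q*q≡1 : ∀ q .{{_ : ℕ.NonZero q}} → ((+ 1) / q) * ℕ→ℚ q ≡ 1ℚ
  1/q*q≡1 (suc q) = trans (cong (_* ℕ→ℚ (suc q)) 1/q≡) (*-inverseˡ (ℕ→ℚ (suc q)) {{q≢0}})
    where
    q≢0 : NonZero (ℕ→ℚ (suc q))
    q≢0 rewrite ℕ→ℚ≡mkℚ (suc q) = _
    1/q≡ : (+ 1) / suc q ≡ (1/ ℕ→ℚ (suc q)) {{q≢0}}
    1/q≡ rewrite ℕ→ℚ≡mkℚ (suc q) = normalize-coprime (1-coprimeTo (suc q))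

  rescale : ∀ q .{{_ : ℕ.NonZero q}} N .{{_ : ℕ.NonZero N}} ε t m l →
    ε * ℕ→ℚ N ≤ ℕ→ℚ t → t ℕ.* m ℕ.≤ l ℕ.* (q ℕ.* N) → (ε * ((+ 1) / q)) * ℕ→ℚ m ≤ ℕ→ℚ l
  rescale q N ε t m l εN≤t tm≤lqN = *-cancelʳ-≤-pos (ℕ→ℚ (q ℕ.* N)) {{qN>0}} (begin
    ε * q⁻¹ * ℕ→ℚ m * ℕ→ℚ (q ℕ.* N)    ≡⟨ cong (ε * q⁻¹ * ℕ→ℚ m *_) (ℕ→ℚ-homo-* q N) ⟩
    ε * q⁻¹ * ℕ→ℚ m * (ℕ→ℚ q * ℕ→ℚ N)  ≡⟨ rearrange ε q⁻¹ (ℕ→ℚ m) (ℕ→ℚ q) (ℕ→ℚ N) ⟩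
    ε * ℕ→ℚ N * ℕ→ℚ m * (q⁻¹ * ℕ→ℚ q)  ≡⟨ cong (ε * ℕ→ℚ N * ℕ→ℚ m *_) (1/q*q≡1 q) ⟩
    ε * ℕ→ℚ N * ℕ→ℚ m * 1ℚ              ≡⟨ *-identityʳ _ ⟩
    ε * ℕ→ℚ N * ℕ→ℚ m                   ≤⟨ *-monoʳ-≤-nonNeg (ℕ→ℚ m) {{normalize-nonNeg m 1}} εN≤t ⟩
    ℕ→ℚ t * ℕ→ℚ m                       ≡⟨ ℕ→ℚ-homo-* t m ⟨
    ℕ→ℚ (t ℕ.* m)                       ≤⟨ ℕ→ℚ-mono-≤ tm≤lqN ⟩
    ℕ→ℚ (l ℕ.* (q ℕ.* N))               ≡⟨ ℕ→ℚ-homo-* l (q ℕ.* N) ⟩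
    ℕ→ℚ l * ℕ→ℚ (q ℕ.* N)               ∎)
    where
    open ≤-Reasoning
    open +-*-Solver
    q⁻¹ = (+ 1) / q
    -- ℕ→ℚ k reduces to normalize k 1.
    qN>0 : Positive (ℕ→ℚ (q ℕ.* N))
    qN>0 = normalize-pos (q ℕ.* N) 1 {{_}} {{ℕ.m*n≢0 q N}}
    rearrange : ∀ a b c d e → a * b * c * (d * e) ≡ a * e * c * (b * d)
    rearrange = solve 5 (λ a b c d e → a :* b :* c :* (d :* e) := a :* e :* c :* (b :* d)) refl


open import Data.Nat using (ℕ; NonZero)
open import Data.Fin using (Fin)
open import Data.Fin.Subset using (Subset)
open import Data.List using (List; length)
open import Data.List.Relation.Unary.Unique.Propositional using (Unique)

module IthMembers {n} (𝓕 : List (Subset n)) (q : ℕ) .{{_ : NonZero q}} (i : Fin q) (T : MarkedFamily n)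
  (T-unique : Unique T) (T-from : IsMarkedFamilyFrom 𝓕 T) (T-strong : IsStrong q T) where

  open Counting
  open Chains
  open Binomials
  open Windows
  open import Data.Nat using (_*_; _∸_; _≤_; _!)
  open import Data.Nat.Properties
  open import Data.Nat.Combinatorics using (_C_)
  open import Data.Nat.ListAction using (sum)
  open import Data.Fin.Subset using (_⊃_; ∣_∣)
  open import Data.Fin.Subset.Properties using (⊂-irref; ∣p∣≤n)
  open import Data.Vec using (lookup; toList)
  open import Data.Vec.Membership.Propositional.Properties using (∈-toList⁺)
  open import Data.List using (map; filter; reverse)
  open import Data.List.Properties using (length-map)
  open import Data.List.Membership.Propositional using (_∈_)
  open import Data.List.Membership.Propositional.Properties using (∈-filter⁺; ∈-filter⁻; ∈-map⁻)
  import Data.List.Membership.DecPropositional as DecMembership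
  open import Data.List.Relation.Binary.Subset.Propositional using () renaming (_⊆_ to _⊆ˡ_)
  open import Data.List.Relation.Unary.All as All using (All)
  import Data.List.Relation.Unary.Any.Properties as Any
  open import Data.List.Relation.Unary.AllPairs as AllPairs using (AllPairs)
  import Data.List.Relation.Unary.AllPairs.Properties as AllPairs
  open import Data.Product using (_×_; _,_; proj₁; proj₂; ∃-syntax)
  open import Data.Product.Properties using (≡-dec)
  open import Function using (_∘_; id)
  open import Algebra.Properties.CommutativeSemigroup *-commutativeSemigroup using (x∙yz≈y∙xz)
  open import Relation.Binary.PropositionalEquality using (_≡_; refl; sym; cong; subst)
  open DecMembership (≡-dec (_≟C_ {n}) (_≟S_ {n})) using (_∈?_)

  module ByChain = Fibres {A = Chain n × Subset n} _≟C_ proj₁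
  module ByMember = Fibres {A = Chain n × Subset n} _≟S_ proj₂

  marked↓ : Chain n → List (Subset n)
  marked↓ χ = filter (λ F → (χ , F) ∈? T) (reverse (toList χ))

  marked↓-decreasing : ∀ {χ} → IsFullChain χ → AllPairs _⊃_ (marked↓ χ)
  marked↓-decreasing {χ} (_ , _ , steps) =
    AllPairs.filter⁺ (λ F → (χ , F) ∈? T) (AllPairs-reverse⁺ (steps⇒increasing χ steps))

  ∈-marked↓⁻ : ∀ {χ F} → F ∈ marked↓ χ → (χ , F) ∈ T
  ∈-marked↓⁻ {χ} F∈ = proj₂ (∈-filter⁻ (λ F → (χ , F) ∈? T) {xs = reverse (toList χ)} F∈)

  ∈-marked↓⁺ : ∀ {χ F} → (χ , F) ∈ T → F ∈ marked↓ χ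
  ∈-marked↓⁺ {χ} χF∈T = ∈-filter⁺ (λ F → (χ , F) ∈? T) (Any.reverse⁺ (∈-toList⁺ F∈χ)) χF∈T
    where F∈χ = proj₂ (proj₂ (T-from χF∈T))

  length-T⟨χ⟩≤marked↓ : ∀ χ → length (T⟨ T ⟩ χ) ≤ length (marked↓ χ)
  length-T⟨χ⟩≤marked↓ χ = Unique∧⊆⇒length≤ _≟S_ T⟨χ⟩-unique T⟨χ⟩⊆marked↓
    where
    fibre-marked : All (λ p → p ∈ T × proj₁ p ≡ χ) (ByChain.fibre T χ)
    fibre-marked = ByChain.fibre-all χ (All.tabulate id)
    T⟨χ⟩-unique : Unique (T⟨ T ⟩ χ)
    T⟨χ⟩-unique = Unique-map⁺-on proj₂ (λ { {_ , _} {_ , _} (_ , refl) (_ , refl) refl → refl })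
      (ByChain.fibre-unique χ T-unique) fibre-marked
    T⟨χ⟩⊆marked↓ : T⟨ T ⟩ χ ⊆ˡ marked↓ χ
    T⟨χ⟩⊆marked↓ F∈ with ∈-map⁻ proj₂ F∈
    ... | _ , χF∈ , refl with All.lookup fibre-marked χF∈
    ...   | χF∈T , refl = ∈-marked↓⁺ χF∈T

  ithMembers : Chain n → List (Subset n)
  ithMembers χ = map (λ Q → lookup Q i) (windows q (marked↓ χ))

  ithMembers-unique : ∀ {χ} → IsFullChain χ → Unique (ithMembers χ)
  ithMembers-unique {χ} full =
    AllPairs.map (λ G⊂F F≡G → ⊂-irref (sym F≡G) G⊂F) (column-pairwise q i (marked↓-decreasing {χ} full))

  ithMember-InPower : ∀ {χ F} → IsFullChain χ → F ∈ ithMembers χ → ∃[ Q ] (InPower q T χ Q × lookup Q i ≡ F)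
  ithMember-InPower {χ} full F∈ with ∈-map⁻ (λ Q → lookup Q i) F∈
  ... | Q , Q∈ , refl =
    Q , (windows-sorted q _ (marked↓-decreasing {χ} full) Q∈ , ∈-marked↓⁻ ∘ ∈-windows⁻ q _ Q∈) , refl

  ithMember-marked : ∀ {χ F} → F ∈ ithMembers χ → (χ , F) ∈ T
  ithMember-marked F∈ with ∈-map⁻ (λ Q → lookup Q i) F∈
  ... | Q , Q∈ , refl = ∈-marked↓⁻ (∈-windows⁻ q _ Q∈ i)

  length-T⟨χ⟩≤q*ithMembers : ∀ {χ F} → (χ , F) ∈ T → length (T⟨ T ⟩ χ) ≤ q * length (ithMembers χ)
  length-T⟨χ⟩≤q*ithMembers {χ} {F} χF∈T = begin
    length (T⟨ T ⟩ χ)                   ≤⟨ length-T⟨χ⟩≤marked↓ χ ⟩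
    length (marked↓ χ)                  ≤⟨ length≤q*windows q (marked↓ χ) q≤marked↓ ⟩
    q * length (windows q (marked↓ χ))  ≡⟨ cong (q *_) (length-map (λ Q → lookup Q i) (windows q (marked↓ χ))) ⟨
    q * length (ithMembers χ)           ∎
    where
    open ≤-Reasoning
    q≤marked↓ = ≤-trans (T-strong χ (F , χF∈T)) (length-T⟨χ⟩≤marked↓ χ)

  chains : List (Chain n)
  chains = ByChain.keys T

  incidences : List (Chain n × Subset n)
  incidences = graph ithMembers chains

  Lⁱ : List (Subset n)
  Lⁱ = ByMember.keys incidences

  incidence-marked : ∀ {χ F} → (χ , F) ∈ incidences → (χ , F) ∈ T
  incidence-marked = ithMember-marked ∘ proj₂ ∘ ∈-graph⁻ ithMembers chains

  incidences-unique : Unique incidences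
  incidences-unique = graph-unique ithMembers (ByChain.keys-unique T) (All.tabulate ithMembers-unique-on-chains)
    where
    ithMembers-unique-on-chains : ∀ {χ} → χ ∈ chains → Unique (ithMembers χ)
    ithMembers-unique-on-chains {χ} χ∈ with ByChain.∈-keys⁻ T χ∈
    ... | _ , χF∈T , refl = ithMembers-unique {χ} (proj₁ (T-from χF∈T))

  incidences-through : ∀ F → length (ByMember.fibre incidences F) ≤ ∣ F ∣ ! * (n ∸ ∣ F ∣) !
  incidences-through F =
    atMost-injective proj₁ (λ { {_ , _} {_ , _} (_ , refl) (_ , refl) refl → refl })
      (λ { (χF∈ , refl) → let full , _ , F∈χ = T-from (incidence-marked χF∈) in full , F∈χ })
      (atMost-fullChains-through F)
      (ByMember.fibre-unique F incidences-unique) (ByMember.fibre-all F (All.tabulate id))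

  |T|≤q*|incidences| : length T ≤ q * length incidences
  |T|≤q*|incidences| = begin
    length T                                            ≤⟨ ByChain.length≤sum-fibres-keys T ⟩
    sum (map (length ∘ ByChain.fibre T) chains)         ≤⟨ sum-map-mono-≤ _ _ (All.tabulate fibre≤) ⟩
    sum (map (λ χ → q * length (ithMembers χ)) chains)  ≡⟨ sum-map-*ˡ q (length ∘ ithMembers) chains ⟩
    q * sum (map (length ∘ ithMembers) chains)          ≡⟨ cong (q *_) (length-graph ithMembers chains) ⟨
    q * length incidences                               ∎
    where
    open ≤-Reasoning
    fibre≤ : ∀ {χ} → χ ∈ chains → length (ByChain.fibre T χ) ≤ q * length (ithMembers χ)
    fibre≤ {χ} χ∈ with ByChain.∈-keys⁻ T χ∈
    ... | _ , χF∈T , refl =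
      subst (_≤ q * length (ithMembers χ)) (length-map proj₂ (ByChain.fibre T χ)) (length-T⟨χ⟩≤q*ithMembers χF∈T)

  min*|incidences|≤|Lⁱ|*n! : minBinom n 𝓕 * length incidences ≤ length Lⁱ * n !
  min*|incidences|≤|Lⁱ|*n! = begin
    m * length incidences                                          ≤⟨ *-monoʳ-≤ m (ByMember.length≤sum-fibres-keys incidences) ⟩
    m * sum (map (length ∘ ByMember.fibre incidences) Lⁱ)          ≡⟨ sum-map-*ˡ m (length ∘ ByMember.fibre incidences) Lⁱ ⟨
    sum (map (λ F → m * length (ByMember.fibre incidences F)) Lⁱ)  ≤⟨ sum-map-mono-≤ _ _ (All.tabulate m*fibre≤n!) ⟩
    sum (map (λ _ → n !) Lⁱ)                                       ≡⟨ sum-map-const (n !) Lⁱ ⟩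
    length Lⁱ * n !                                                ∎
    where
    open ≤-Reasoning
    m = minBinom n 𝓕
    m*fibre≤n! : ∀ {F} → F ∈ Lⁱ → m * length (ByMember.fibre incidences F) ≤ n !
    m*fibre≤n! F∈ with ByMember.∈-keys⁻ incidences F∈
    ... | (_ , F) , χF∈ , refl = begin
      m * length (ByMember.fibre incidences F)  ≤⟨ *-mono-≤ (minBinom≤ F∈𝓕) (incidences-through F) ⟩
      (n C ∣ F ∣) * (∣ F ∣ ! * (n ∸ ∣ F ∣) !)   ≤⟨ nCk*k!*[n∸k]!≤n! n ∣ F ∣ (∣p∣≤n F) ⟩
      n !                                       ∎
      where F∈𝓕 = proj₁ (proj₂ (T-from (incidence-marked χF∈)))

  Lⁱ-unique : Unique Lⁱ
  Lⁱ-unique = ByMember.keys-unique incidences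

  Lⁱ-members : All (InL 𝓕 q T i) Lⁱ
  Lⁱ-members = All.tabulate member
    where
    member : ∀ {F} → F ∈ Lⁱ → InL 𝓕 q T i F
    member F∈ with ByMember.∈-keys⁻ incidences F∈
    ... | (χ , F) , χF∈ , refl =
      let full , F∈𝓕 , _ = T-from (incidence-marked χF∈)
      in F∈𝓕 , χ , ithMember-InPower full (proj₂ (∈-graph⁻ ithMembers chains χF∈))

  |T|*min≤|Lⁱ|*[q*n!] : length T * minBinom n 𝓕 ≤ length Lⁱ * (q * n !)
  |T|*min≤|Lⁱ|*[q*n!] = begin
    length T * m                 ≤⟨ *-monoˡ-≤ m |T|≤q*|incidences| ⟩
    q * length incidences * m    ≡⟨ *-assoc q (length incidences) m ⟩
    q * (length incidences * m)  ≡⟨ cong (q *_) (*-comm (length incidences) m) ⟩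
    q * (m * length incidences)  ≤⟨ *-monoʳ-≤ q min*|incidences|≤|Lⁱ|*n! ⟩
    q * (length Lⁱ * n !)        ≡⟨ x∙yz≈y∙xz q (length Lⁱ) (n !) ⟩
    length Lⁱ * (q * n !)        ∎
    where
    open ≤-Reasoning
    m = minBinom n 𝓕

open import Data.Nat using (_!)
open import Data.Nat.Properties using (_!≢0)
open import Data.List.Relation.Unary.All using (All)
open import Data.Product using (_×_; _,_; ∃-syntax)
open import Data.Integer using (+_)
open import Data.Rational using (ℚ; 0ℚ; _<_; _≤_; _*_; _/_)
open Rescaling using (rescale)

lemma4p3 : (n : ℕ) (𝓕 : List (Subset n)) (q : ℕ) .{{_ : NonZero q}}
    (ε : ℚ) → 0ℚ < ε →
    (T : MarkedFamily n) → Unique T → IsMarkedFamilyFrom 𝓕 T → IsStrong q T →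
    ε * ℕ→ℚ (n !) ≤ ℕ→ℚ (length T) →
    (i : Fin q) →
    ∃[ L ] (Unique L × All (InL 𝓕 q T i) L ×
      ((ε * ((+ 1) / q)) * ℕ→ℚ (minBinom n 𝓕) ≤ ℕ→ℚ (length L)))
lemma4p3 n 𝓕 q ε _ T T-unique T-from T-strong εn!≤|T| i =
  Lⁱ , Lⁱ-unique , Lⁱ-members ,
  rescale q (n !) {{n !≢0}} ε (length T) (minBinom n 𝓕) (length Lⁱ) εn!≤|T| |T|*min≤|Lⁱ|*[q*n!]
  where open IthMembers 𝓕 q i T T-unique T-from T-strong
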